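{- For any formula $\phi_0$ of $\mathcal L$: (1) if $\nvdash_\Re\phi_0$, then there is a world $w$ of some Kripke model $\langle W,\rightarrow,\Vdash\rangle$ such that $w\nVdash\phi_0$; (2) if $\nvdash_{\Re_d}\phi_0$, then there is a world $w$ of some deterministic Kripke model $\langle W,\rightarrow,\Vdash\rangle$ such that $w\nVdash\phi_0$.
   Context: The language $\mathcal L$: formulas built from propositional variables and $\bot$ using $\rightarrow$ and a binary modality $\rhd$; $\wedge,\vee,\neg,\top$ defined as usual. The logic $\Re$: classical propositional logic in $\mathcal L$ plus axioms A1: $\phi\rhd\psi\rightarrow(\chi\rhd\psi\rightarrow(\phi\vee\chi)\rhd\psi)$, A2: $\bot\rhd\phi$, A3: $\phi\rhd\top$, with rules Modus Ponens and M: from $\phi_1\rightarrow\phi_2$ and $\psi_1\rightarrow\psi_2$ infer $\phi_2\rhd\psi_1\rightarrow\phi_1\rhd\psi_2$. The logic $\Re_d$ is $\Re$ plus axiom A4: $\phi\rhd\psi\rightarrow(\phi\rhd\chi\rightarrow\phi\rhd(\psi\wedge\chi))$. A Kripke model is a triple $\langle W,\rightarrow,\Vdash\rangle$ where $W$ is a finite set of worlds, $\rightarrow$ is a ternary relation on $W$ written $u\rightarrow_w v$, and $\Vdash$ is a relation between worlds and propositional variables, extended to all formulas by: $w\nVdash\bot$; $w\Vdash\phi\rightarrow\psi$ iff $w\nVdash\phi$ or $w\Vdash\psi$; $w\Vdash\phi\rhd\psi$ iff for all worlds $u,v$ with $u\rightarrow_w v$ and $u\Vdash\phi$ there is a world $v'$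 with $u\rightarrow_w v'$ and $v'\Vdash\psi$. A Kripke model is deterministic if for all $w,u\in W$ there is at most one $v\in W$ with $u\rightarrow_w v$. -}

module Defs where

open import Data.Nat using (ℕ)
open import Data.Fin using (Fin)
open import Data.Bool using (Bool; true; false; T)
open import Data.Empty using (⊥)
open import Data.Product using (Σ; ∃; _×_)
open import Relation.Binary.PropositionalEquality using (_≡_)

infixr 5 _⇒_
infix 6 _▷_

data Form : Set where
  var : ℕ → Form
  ⊥'  : Form
  _⇒_ : Form → Form → Form
  _▷_ : Form → Form → Form

¬' : Form → Form
¬' φ = φ ⇒ ⊥'

⊤' : Form
⊤' = ¬' ⊥'

_∨'_ : Form → Form → Form
φ ∨' ψ = ¬' φ ⇒ ψ

_∧'_ : Form → Form → Form
φ ∧' ψ = ¬' (φ ⇒ ¬' ψ)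

-- Classical propositional logic is given by the
-- standard complete axiomatisation in {→, ⊥}: K, S, double-negation elimination,
-- with Modus Ponens (all instances in the full language L).
data ⊢[_]_ (d : Bool) : Form → Set where
  ax-K  : ∀ φ ψ → ⊢[ d ] (φ ⇒ ψ ⇒ φ)
  ax-S  : ∀ φ ψ χ → ⊢[ d ] ((φ ⇒ ψ ⇒ χ) ⇒ (φ ⇒ ψ) ⇒ φ ⇒ χ)
  ax-DN : ∀ φ → ⊢[ d ] (¬' (¬' φ) ⇒ φ)
  ax-A1 : ∀ φ ψ χ → ⊢[ d ] ((φ ▷ ψ) ⇒ (χ ▷ ψ) ⇒ ((φ ∨' χ) ▷ ψ))
  ax-A2 : ∀ φ → ⊢[ d ] (⊥' ▷ φ)
  ax-A3 : ∀ φ → ⊢[ d ] (φ ▷ ⊤')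
  ax-A4 : T d → ∀ φ ψ χ → ⊢[ d ] ((φ ▷ ψ) ⇒ (φ ▷ χ) ⇒ (φ ▷ (ψ ∧' χ)))
  mp    : ∀ {φ ψ} → ⊢[ d ] (φ ⇒ ψ) → ⊢[ d ] φ → ⊢[ d ] ψ
  rule-M : ∀ {φ₁ φ₂ ψ₁ ψ₂} → ⊢[ d ] (φ₁ ⇒ φ₂) → ⊢[ d ] (ψ₁ ⇒ ψ₂) →
           ⊢[ d ] ((φ₂ ▷ ψ₁) ⇒ (φ₁ ▷ ψ₂))

⊢R_ : Form → Set
⊢R φ = ⊢[ false ] φ

⊢Rd_ : Form → Set
⊢Rd φ = ⊢[ true ] φ

record Model : Set where
  field
    n   : ℕ
    R   : Fin n → Fin n → Fin n → Bool   -- R w u v = true  iff  u →_w v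
    val : Fin n → ℕ → Bool

open Model public

_⊩_ : (M : Model) → Fin (n M) → Form → Set
(M ⊩ w) (var p) = T (val M w p)
(M ⊩ w) ⊥' = ⊥
(M ⊩ w) (φ ⇒ ψ) = (M ⊩ w) φ → (M ⊩ w) ψ
(M ⊩ w) (φ ▷ ψ) =
  ∀ (u v : Fin (n M)) → T (R M w u v) → (M ⊩ u) φ →
    Σ (Fin (n M)) λ v' → T (R M w u v') × (M ⊩ v') ψ

Deterministic : Model → Set
Deterministic M = ∀ (w u v v' : Fin (n M)) → T (R M w u v) → T (R M w u v') → v ≡ v'

{-# OPTIONS --safe #-}
module Submission where

-- Completeness by a finite canonical model.  Let S be the subformulas of φ₀.  An atom
-- assigns a truth value to every θ ∈ S, and conj s is the conjunction of its literals.
-- A world is an atom together with a tag ψ ∈ S; u →_w v is allowed only if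
-- conj u ▷ tag u is not derivable from conj w, and then v ranges over consistent
-- atoms refuting tag u.  The rules A1–A3 and M make the truth lemma go through:
-- a consistent world forces exactly the formulas of S true in its atom.  For R_d,
-- A4 merges all ▷-requirements that w places on u into one formula, so a single
-- successor suffices and the model is deterministic.
--
-- Consistency cannot be decided constructively before the theorem is proved, so the
-- canonical relation only exists under double negation.  But whether a given relation
-- table refutes φ₀ is decidable, and there are finitely many tables, so exhaustive
-- search removes the double negation.

open import Defs
open import Data.Fin using (Fin)
open import Data.Product using (Σ; _×_)
open import Relation.Nullary using (¬_)

open import Level using (0ℓ)
open import Data.Bool using (Bool; true; false; T)
open import Data.Empty using (⊥-elim)
open import Data.Fin using (zero; suc)
import Data.Fin.Properties as Fin
open import Data.List using (List; []; _∷_; _++_; [_]; map; cartesianProduct; length)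
  renaming (lookup to lookupᴸ)
open import Data.List.Membership.Propositional using (_∈_)
open import Data.List.Membership.Propositional.Properties
  using (∈-++⁺ˡ; ∈-++⁺ʳ; ∈-++⁻; ∈-map⁺; ∈-cartesianProduct⁺; ∈-cartesianProduct⁻; ∈-lookup)
open import Data.List.Relation.Binary.Subset.Propositional using (_⊆_)
open import Data.List.Relation.Unary.All using (All; []; _∷_)
import Data.List.Relation.Unary.All as All
import Data.List.Relation.Unary.All.Properties as All
import Data.List.Relation.Unary.Any as Any
open import Data.List.Relation.Unary.Any using (here; there; index)
open import Data.List.Relation.Unary.Any.Properties using (lookup-index)
open import Data.Nat as ℕ using (ℕ; zero; suc)
open import Data.Product using (∃; _,_; proj₁; proj₂; uncurry; map₂)
open import Data.Sum using (inj₁; inj₂)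
open import Data.Unit using (tt)
open import Data.Vec using (Vec; []; _∷_; lookup)
open import Effect.Monad using (RawMonad)
open import Function using (_∘_; id; const; _⇔_; mk⇔; Equivalence)
open import Relation.Binary.Definitions using (DecidableEquality)
open import Relation.Binary.PropositionalEquality using (_≡_; refl; cong; subst)
open import Relation.Nullary using (Dec; yes; no)
open import Relation.Nullary.Decidable
  using ( map′; _×-dec_; _⊎-dec_; _→-dec_; T?; ¬?; ⌊_⌋; toWitness; fromWitness
        ; decidable-stable; ¬¬-excluded-middle)
open import Relation.Nullary.Negation using (¬¬-Monad; ¬¬-map; DoubleNegation)
open import Relation.Unary using (Pred; Decidable)

open Equivalence using (to; from)
open RawMonad (¬¬-Monad {a = 0ℓ})

-- Double negation and exhaustive search

¬¬_ : Set → Set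
¬¬_ = DoubleNegation

¬¬-finite-choice : ∀ {A : Set} m {P : Fin m → A → Set} →
                   (∀ i → ¬¬ Σ A (P i)) → ¬¬ Σ (Vec A m) λ v → ∀ i → P i (lookup v i)
¬¬-finite-choice zero    choose = return ([] , λ ())
¬¬-finite-choice (suc m) choose = do
  a , pa ← choose zero
  v , pv ← ¬¬-finite-choice m (choose ∘ suc)
  return (a ∷ v , λ { zero → pa ; (suc i) → pv i })

¬¬-decide : (A : Set) → ¬¬ Σ Bool λ b → T b ⇔ A
¬¬-decide A = do
  a? ← ¬¬-excluded-middle
  return (⌊ a? ⌋ , mk⇔ toWitness fromWitness)

¬¬-independence-of-premise : ∀ {A B : Set} {P : A → Set} →
                             A → (B → ¬¬ Σ A P) → ¬¬ Σ A λ a → B → P a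
¬¬-independence-of-premise a f = ¬¬-excluded-middle >>= λ where
  (yes b) → ¬¬-map (map₂ const) (f b)
  (no ¬b) → return (a , ⊥-elim ∘ ¬b)

Exhaustible : Set → Set₁
Exhaustible A = ∀ {P : Pred A 0ℓ} → Decidable P → Dec (∃ P)

exhaustible-Bool : Exhaustible Bool
exhaustible-Bool P? = map′ (λ { (inj₁ p) → true , p ; (inj₂ p) → false , p })
                           (λ { (true , p) → inj₁ p ; (false , p) → inj₂ p })
                           (P? true ⊎-dec P? false)

exhaustible-Vec : ∀ {A} → Exhaustible A → ∀ m → Exhaustible (Vec A m)
exhaustible-Vec search zero    P? = map′ ([] ,_) (λ { ([] , p) → p }) (P? [])
exhaustible-Vec search (suc m) P? =
  map′ (λ (a , v , p) → a ∷ v , p) (λ { (a ∷ v , p) → a , v , p })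
       (search λ a → exhaustible-Vec search m λ v → P? (a ∷ v))

Table : ℕ → Set
Table m = Vec (Vec (Vec Bool m) m) m

entry : ∀ {m} → Table m → Fin m → Fin m → Fin m → Bool
entry t w u v = lookup (lookup (lookup t w) u) v

Tabulates : ∀ {m} → Table m → (Fin m → Fin m → Fin m → Set) → Set
Tabulates t Rel = ∀ w u v → T (entry t w u v) ⇔ Rel w u v

¬¬-tabulation : ∀ {m} (Rel : Fin m → Fin m → Fin m → Set) → ¬¬ Σ (Table m) λ t → Tabulates t Rel
¬¬-tabulation {m} Rel =
  ¬¬-finite-choice m λ w → ¬¬-finite-choice m λ u → ¬¬-finite-choice m λ v → ¬¬-decide (Rel w u v)

search-Table : ∀ {m} {P : Table m → Set} → Decidable P → ¬¬ ∃ P → ∃ P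
search-Table {m} P? =
  decidable-stable (exhaustible-Vec (exhaustible-Vec (exhaustible-Vec exhaustible-Bool m) m) m P?)

infix 4 _≟_
_≟_ : DecidableEquality Form
var p   ≟ var q   = map′ (cong var) (λ { refl → refl }) (p ℕ.≟ q)
⊥'      ≟ ⊥'      = yes refl
(a ⇒ b) ≟ (c ⇒ e) = map′ (λ { (refl , refl) → refl }) (λ { refl → refl , refl }) (a ≟ c ×-dec b ≟ e)
(a ▷ b) ≟ (c ▷ e) = map′ (λ { (refl , refl) → refl }) (λ { refl → refl , refl }) (a ≟ c ×-dec b ≟ e)
var _   ≟ ⊥'      = no λ ()
var _   ≟ (_ ⇒ _) = no λ ()
var _   ≟ (_ ▷ _) = no λ ()
⊥'      ≟ var _   = no λ ()
⊥'      ≟ (_ ⇒ _) = no λ ()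
⊥'      ≟ (_ ▷ _) = no λ ()
(_ ⇒ _) ≟ var _   = no λ ()
(_ ⇒ _) ≟ ⊥'      = no λ ()
(_ ⇒ _) ≟ (_ ▷ _) = no λ ()
(_ ▷ _) ≟ var _   = no λ ()
(_ ▷ _) ≟ ⊥'      = no λ ()
(_ ▷ _) ≟ (_ ⇒ _) = no λ ()

subformulas : Form → List Form
subformulas (a ⇒ b) = (a ⇒ b) ∷ subformulas a ++ subformulas b
subformulas (a ▷ b) = (a ▷ b) ∷ subformulas a ++ subformulas b
subformulas φ       = φ ∷ []

subformulas-refl : ∀ φ → φ ∈ subformulas φ
subformulas-refl (var _) = here refl
subformulas-refl ⊥'      = here refl
subformulas-refl (_ ⇒ _) = here refl
subformulas-refl (_ ▷ _) = here refl

subformulas-trans : ∀ φ {θ χ} → θ ∈ subformulas φ → χ ∈ subformulas θ → χ ∈ subformulas φ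
subformulas-trans (var _) (here refl) q = q
subformulas-trans ⊥'      (here refl) q = q
subformulas-trans (a ⇒ b) (here refl) q = q
subformulas-trans (a ⇒ b) (there p)   q with ∈-++⁻ (subformulas a) p
... | inj₁ pa = there (∈-++⁺ˡ (subformulas-trans a pa q))
... | inj₂ pb = there (∈-++⁺ʳ (subformulas a) (subformulas-trans b pb q))
subformulas-trans (a ▷ b) (here refl) q = q
subformulas-trans (a ▷ b) (there p)   q with ∈-++⁻ (subformulas a) p
... | inj₁ pa = there (∈-++⁺ˡ (subformulas-trans a pa q))
... | inj₂ pb = there (∈-++⁺ʳ (subformulas a) (subformulas-trans b pb q))

⊩-dec : (M : Model) → ∀ w φ → Dec ((M ⊩ w) φ)
⊩-dec M w (var p) = T? _
⊩-dec M w ⊥'      = no λ ()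
⊩-dec M w (φ ⇒ ψ) = ⊩-dec M w φ →-dec ⊩-dec M w ψ
⊩-dec M w (φ ▷ ψ) =
  Fin.all? λ u → Fin.all? λ v → T? (R M w u v) →-dec ⊩-dec M u φ →-dec
    Fin.any? λ v' → T? (R M w u v') ×-dec ⊩-dec M v' ψ

deterministic? : (M : Model) → Dec (Deterministic M)
deterministic? M =
  Fin.all? λ w → Fin.all? λ u → Fin.all? λ v → Fin.all? λ v' →
    T? (R M w u v) →-dec T? (R M w u v') →-dec v Fin.≟ v'

-- Atoms

Atom : List Form → Set
Atom = All (λ _ → Bool)

atoms : ∀ L → List (Atom L)
atoms []      = [ [] ]
atoms (_ ∷ L) = map (true ∷_) (atoms L) ++ map (false ∷_) (atoms L)

atoms-complete : ∀ {L} (s : Atom L) → s ∈ atoms L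
atoms-complete []          = here refl
atoms-complete (true ∷ s)  = ∈-++⁺ˡ (∈-map⁺ (true ∷_) (atoms-complete s))
atoms-complete (false ∷ s) = ∈-++⁺ʳ (map (true ∷_) (atoms _)) (∈-map⁺ (false ∷_) (atoms-complete s))

value : ∀ {L} → Atom L → Form → Bool
value []                θ = false
value {θ' ∷ _} (b ∷ s) θ with θ ≟ θ'
... | yes _ = b
... | no  _ = value s θ

infix 4 _∋_ _∋?_
_∋_ : ∀ {L} → Atom L → Form → Set
s ∋ θ = T (value s θ)

_∋?_ : ∀ {L} (s : Atom L) θ → Dec (s ∋ θ)
s ∋? θ = T? (value s θ)

literal : Bool → Form → Form
literal true  θ = θ
literal false θ = ¬' θ

literal-true : ∀ {b θ} → T b → literal b θ ≡ θ
literal-true {true} _ = refl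

literal-false : ∀ {b θ} → ¬ T b → literal b θ ≡ ¬' θ
literal-false {false} _  = refl
literal-false {true}  ¬t = ⊥-elim (¬t _)

literals : ∀ {L} → Atom L → List Form
literals []               = []
literals {θ ∷ _} (b ∷ s) = literal b θ ∷ literals s

literal-∈ : ∀ {L θ} (s : Atom L) → θ ∈ L → literal (value s θ) θ ∈ literals s
literal-∈ {θ' ∷ _} {θ} (b ∷ s) q with θ ≟ θ'
... | yes refl  = here refl
... | no  θ≢θ' = there (literal-∈ s (Any.tail θ≢θ' q))

⋀ : List Form → Form
⋀ []       = ⊤'
⋀ (φ ∷ φs) = φ ∧' ⋀ φs

conj : ∀ {L} → Atom L → Form
conj s = ⋀ (literals s)

module Derivations (d : Bool) where

  infix 3 _⊢_
  data _⊢_ (Γ : List Form) : Form → Set where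
    hyp : ∀ {φ} → φ ∈ Γ → Γ ⊢ φ
    thm : ∀ {φ} → ⊢[ d ] φ → Γ ⊢ φ
    app : ∀ {φ ψ} → Γ ⊢ φ ⇒ ψ → Γ ⊢ φ → Γ ⊢ ψ

  variable
    Γ Δ   : List Form
    φs L  : List Form
    a b c φ ψ χ θ : Form

  hyp₀ : φ ∷ Γ ⊢ φ
  hyp₀ = hyp (here refl)

  hyp₁ : ψ ∷ φ ∷ Γ ⊢ φ
  hyp₁ = hyp (there (here refl))

  hyp₂ : χ ∷ ψ ∷ φ ∷ Γ ⊢ φ
  hyp₂ = hyp (there (there (here refl)))

  ⇒-refl : ⊢[ d ] (φ ⇒ φ)
  ⇒-refl {φ} = mp (mp (ax-S φ (φ ⇒ φ) φ) (ax-K φ (φ ⇒ φ))) (ax-K φ φ)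

  deduction : φ ∷ Γ ⊢ ψ → Γ ⊢ φ ⇒ ψ
  deduction (hyp (here refl)) = thm ⇒-refl
  deduction (hyp (there p))   = app (thm (ax-K _ _)) (hyp p)
  deduction (thm p)           = app (thm (ax-K _ _)) (thm p)
  deduction (app p q)         = app (app (thm (ax-S _ _ _)) (deduction p)) (deduction q)

  closed : [] ⊢ φ → ⊢[ d ] φ
  closed (thm p)   = p
  closed (app p q) = mp (closed p) (closed q)

  weaken : Γ ⊆ Δ → Γ ⊢ φ → Δ ⊢ φ
  weaken Γ⊆Δ (hyp p)   = hyp (Γ⊆Δ p)
  weaken Γ⊆Δ (thm p)   = thm p
  weaken Γ⊆Δ (app p q) = app (weaken Γ⊆Δ p) (weaken Γ⊆Δ q)

  cut : [ φ ] ⊢ ψ → Γ ⊢ φ → Γ ⊢ ψ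
  cut p q = app (thm (closed (deduction p))) q

  ⊥'-elim : Γ ⊢ ⊥' → Γ ⊢ φ
  ⊥'-elim {φ = φ} p = app (thm (ax-DN φ)) (app (thm (ax-K ⊥' (¬' φ))) p)

  by-contradiction : ¬' φ ∷ Γ ⊢ ⊥' → Γ ⊢ φ
  by-contradiction p = app (thm (ax-DN _)) (deduction p)

  ⊤'-intro : Γ ⊢ ⊤'
  ⊤'-intro = thm ⇒-refl

  ∧'-intro : Γ ⊢ φ → Γ ⊢ ψ → Γ ⊢ φ ∧' ψ
  ∧'-intro p q = deduction (app (app hyp₀ (weaken there p)) (weaken there q))

  ∧'-elim₁ : Γ ⊢ φ ∧' ψ → Γ ⊢ φ
  ∧'-elim₁ p = by-contradiction (app (weaken there p) (deduction (deduction (app hyp₂ hyp₁))))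

  ∧'-elim₂ : Γ ⊢ φ ∧' ψ → Γ ⊢ ψ
  ∧'-elim₂ p = by-contradiction (app (weaken there p) (deduction hyp₁))

  ⋀-elim : φ ∈ φs → Γ ⊢ ⋀ φs → Γ ⊢ φ
  ⋀-elim (here refl) p = ∧'-elim₁ p
  ⋀-elim (there q)   p = ⋀-elim q (∧'-elim₂ p)

  ▷-mono : [ a ] ⊢ b → [ ψ ] ⊢ χ → Γ ⊢ b ▷ ψ → Γ ⊢ a ▷ χ
  ▷-mono p q r = app (thm (rule-M (closed (deduction p)) (closed (deduction q)))) r

  ▷-∨ : Γ ⊢ a ▷ ψ → Γ ⊢ b ▷ ψ → Γ ⊢ (a ∨' b) ▷ ψ
  ▷-∨ p q = app (app (thm (ax-A1 _ _ _)) p) q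

  ▷-⊥ : [ a ] ⊢ ⊥' → Γ ⊢ a ▷ ψ
  ▷-⊥ p = ▷-mono p hyp₀ (thm (ax-A2 _))

  ▷-⊤ : Γ ⊢ a ▷ ⊤'
  ▷-⊤ = thm (ax-A3 _)

  ▷-⋀ : T d → All (λ φ → Γ ⊢ a ▷ φ) φs → Γ ⊢ a ▷ ⋀ φs
  ▷-⋀ A4 []       = ▷-⊤
  ▷-⋀ A4 (p ∷ ps) = app (app (thm (ax-A4 A4 _ _ _)) p) (▷-⋀ A4 ps)

  conj-∋ : (s : Atom L) → Γ ⊢ conj s → θ ∈ L → s ∋ θ → Γ ⊢ θ
  conj-∋ s p q ∋θ = subst (_ ⊢_) (literal-true ∋θ) (⋀-elim (literal-∈ s q) p)

  conj-∌ : (s : Atom L) → Γ ⊢ conj s → θ ∈ L → ¬ s ∋ θ → Γ ⊢ ¬' θ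
  conj-∌ s p q ∌θ = subst (_ ⊢_) (literal-false ∌θ) (⋀-elim (literal-∈ s q) p)

  ∌-complete : (s : Atom L) → Γ ⊢ conj s → ¬ (Γ ⊢ ⊥') → θ ∈ L → Γ ⊢ ¬' θ → ¬ s ∋ θ
  ∌-complete s p con q ¬θ ∋θ = con (app ¬θ (conj-∋ s p q ∋θ))

  ∋-complete : (s : Atom L) → Γ ⊢ conj s → ¬ (Γ ⊢ ⊥') → θ ∈ L → Γ ⊢ θ → s ∋ θ
  ∋-complete s p con q ⊢θ = decidable-stable (s ∋? _) λ ∌θ → con (app (conj-∌ s p q ∌θ) ⊢θ)

  Consistent : Form → Set
  Consistent φ = ¬ ([ φ ] ⊢ ⊥')

  consistent-∧ʳ : Consistent (φ ∧' ψ) → Consistent ψ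
  consistent-∧ʳ con p = con (cut p (∧'-elim₂ hyp₀))

  ∋-⇒ : (s : Atom L) → Consistent (conj s) → (a ⇒ b) ∈ L → a ∈ L → b ∈ L →
        s ∋ a ⇒ b ⇔ (s ∋ a → s ∋ b)
  ∋-⇒ {a = a} {b = b} s con q qa qb = mk⇔
    (λ ∋a⇒b ∋a → ∋-complete s hyp₀ con qb (app (conj-∋ s hyp₀ q ∋a⇒b) (conj-∋ s hyp₀ qa ∋a)))
    (∋-complete s hyp₀ con q ∘ implication)
    where
    implication : (s ∋ a → s ∋ b) → [ conj s ] ⊢ a ⇒ b
    implication f with s ∋? a
    ... | yes ∋a = deduction (conj-∋ s hyp₁ qb (f ∋a))
    ... | no  ∌a = deduction (⊥'-elim (app (conj-∌ s hyp₁ qa ∌a) hyp₀))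

  module _ (Q : Form → Set) (Q-antitone : ∀ {a b} → [ a ] ⊢ b → Q b → Q a)
           (Q-∨ : ∀ {a b} → Q a → Q b → Q (a ∨' b)) where

    -- c is equivalent to the disjunction of the c ∧ conj t over all atoms t, so Q fails on one of them.
    escape : ∀ L c → ¬ Q c → ¬¬ Σ (Atom L) λ t → ¬ Q (c ∧' conj t)
    escape []      c ¬Qc k = k ([] , ¬Qc ∘ Q-antitone (∧'-intro hyp₀ ⊤'-intro))
    escape (θ ∷ L) c ¬Qc k =
      escape L (c ∧' θ)
        (λ Q⁺ → escape L (c ∧' ¬' θ) (λ Q⁻ → ¬Qc (Q-antitone split (Q-∨ Q⁺ Q⁻))) (k ∘ extend false))
        (k ∘ extend true)
      where
      split : [ c ] ⊢ (c ∧' θ) ∨' (c ∧' ¬' θ)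
      split = deduction (∧'-intro hyp₁ (deduction (app hyp₁ (∧'-intro hyp₂ hyp₀))))

      extend : ∀ b → Σ (Atom L) (λ t → ¬ Q ((c ∧' literal b θ) ∧' conj t)) →
               Σ (Atom (θ ∷ L)) λ t → ¬ Q (c ∧' conj t)
      extend b (t , ¬Q) = b ∷ t , ¬Q ∘ Q-antitone reassoc
        where
        reassoc : [ (c ∧' literal b θ) ∧' conj t ] ⊢ c ∧' (literal b θ ∧' conj t)
        reassoc = ∧'-intro (∧'-elim₁ (∧'-elim₁ hyp₀))
                           (∧'-intro (∧'-elim₂ (∧'-elim₁ hyp₀)) (∧'-elim₂ hyp₀))

  extend-to-atom : ∀ L → Consistent c → ¬¬ Σ (Atom L) λ t → Consistent (c ∧' conj t)
  extend-to-atom L = escape (λ φ → [ φ ] ⊢ ⊥') (λ a⊢b b⊢⊥ → cut b⊢⊥ a⊢b)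
    (λ a⊢⊥ b⊢⊥ → cut b⊢⊥ (app hyp₀ (thm (closed (deduction a⊢⊥))))) L _

  escape-▷ : ∀ L → ¬ (Γ ⊢ c ▷ ψ) → ¬¬ Σ (Atom L) λ t → ¬ (Γ ⊢ (c ∧' conj t) ▷ ψ)
  escape-▷ {Γ = Γ} {ψ = ψ} L = escape (λ φ → Γ ⊢ φ ▷ ψ) (λ a⊢b → ▷-mono a⊢b hyp₀) ▷-∨ L _

module CanonicalModel (d : Bool) (φ₀ : Form) where
  open Derivations d

  S : List Form
  S = subformulas φ₀

  φ₀∈S : φ₀ ∈ S
  φ₀∈S = subformulas-refl φ₀

  ⇒-closed : (a ⇒ b) ∈ S → a ∈ S × b ∈ S
  ⇒-closed {a} {b} p = subformulas-trans φ₀ p (there (∈-++⁺ˡ (subformulas-refl a))) ,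
                       subformulas-trans φ₀ p (there (∈-++⁺ʳ (subformulas a) (subformulas-refl b)))

  ▷-closed : (a ▷ b) ∈ S → a ∈ S × b ∈ S
  ▷-closed {a} {b} p = subformulas-trans φ₀ p (there (∈-++⁺ˡ (subformulas-refl a))) ,
                       subformulas-trans φ₀ p (there (∈-++⁺ʳ (subformulas a) (subformulas-refl b)))

  worlds : List (Atom S × Form)
  worlds = cartesianProduct (atoms S) S

  World : Set
  World = Fin (length worlds)

  atom : World → Atom S
  atom w = proj₁ (lookupᴸ worlds w)

  tag : World → Form
  tag w = proj₂ (lookupᴸ worlds w)

  variable
    w u v : World

  tag-∈ : ∀ w → tag w ∈ S
  tag-∈ w = proj₂ (∈-cartesianProduct⁻ (atoms S) S (∈-lookup w))

  world : ∀ (P : Atom S → Form → Set) {s ψ} → P s ψ → ψ ∈ S → Σ World λ w → P (atom w) (tag w)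
  world P {s} p q = index i , subst (uncurry P) (lookup-index i) p
    where i = ∈-cartesianProduct⁺ (atoms-complete s) q

  world-with-atom : ∀ (P : Atom S → Set) {s} → P s → Σ World (P ∘ atom)
  world-with-atom P p = world (λ s _ → P s) p φ₀∈S

  model : Table (length worlds) → Model
  model t = record { n = length worlds ; R = entry t ; val = λ w p → value (atom w) (var p) }

  model-deterministic : ∀ {Rel} t → Tabulates t Rel →
                        (∀ {w u v v'} → Rel w u v → Rel w u v' → v ≡ v') → Deterministic (model t)
  model-deterministic t tab functional w u v v' r r' = functional (to (tab w u v) r) (to (tab w u v') r')

  Admissible : World → World → Set
  Admissible w u = ¬ ([ conj (atom w) ] ⊢ conj (atom u) ▷ tag u)

  admissible-consistent : Admissible w u → Consistent (conj (atom u))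
  admissible-consistent adm = adm ∘ ▷-⊥

  refuting-world : ¬ ⊢[ d ] φ₀ → ¬¬ Σ World λ w → Consistent (conj (atom w)) × ¬ atom w ∋ φ₀
  refuting-world ⊬φ₀ = do
    s , con ← extend-to-atom S (⊬φ₀ ∘ closed ∘ by-contradiction)
    return (world-with-atom (λ s → Consistent (conj s) × ¬ s ∋ φ₀)
              (consistent-∧ʳ con , ∌-complete s (∧'-elim₂ hyp₀) con φ₀∈S (∧'-elim₁ hyp₀)))

  ▷-witness : (φ ▷ ψ) ∈ S → Consistent (conj (atom w)) → ¬ atom w ∋ φ ▷ ψ →
              ¬¬ Σ World λ u → atom u ∋ φ × tag u ≡ ψ × Admissible w u
  ▷-witness {φ} {ψ} {w} q con ∌▷ = do
    s , ¬▷ ← escape-▷ S (con ∘ app (conj-∌ (atom w) hyp₀ q ∌▷))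
    return (world (λ s χ → s ∋ φ × χ ≡ ψ × ¬ ([ conj (atom w) ] ⊢ conj s ▷ χ))
              (∋-complete s (∧'-elim₂ hyp₀) (¬▷ ∘ ▷-⊥) (proj₁ (▷-closed q)) (∧'-elim₁ hyp₀) ,
               refl , ¬▷ ∘ ▷-mono (∧'-elim₂ hyp₀) hyp₀)
              (proj₂ (▷-closed q)))

  conj-▷ : (φ ▷ ψ) ∈ S → atom w ∋ φ ▷ ψ → atom u ∋ φ → [ conj (atom w) ] ⊢ conj (atom u) ▷ ψ
  conj-▷ {w = w} {u = u} q ∋▷ ∋φ =
    ▷-mono (conj-∋ (atom u) hyp₀ (proj₁ (▷-closed q)) ∋φ) hyp₀ (conj-∋ (atom w) hyp₀ q ∋▷)

  successor-exists : Admissible w u → [ conj (atom w) ] ⊢ conj (atom u) ▷ χ →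
    ¬¬ Σ World λ v → Consistent (conj (atom v)) × ¬ atom v ∋ tag u ×
                     (∀ {θ} → θ ∈ S → [ χ ] ⊢ θ → atom v ∋ θ)
  successor-exists {u = u} {χ = χ} adm ⊢▷χ = do
    s , con ← extend-to-atom S λ ⊢⊥ →
      adm (▷-mono hyp₀ (by-contradiction (cut ⊢⊥ (∧'-intro hyp₁ hyp₀))) ⊢▷χ)
    return (world-with-atom
              (λ s → Consistent (conj s) × ¬ s ∋ tag u × (∀ {θ} → θ ∈ S → [ χ ] ⊢ θ → s ∋ θ))
              (consistent-∧ʳ con ,
               ∌-complete s (∧'-elim₂ hyp₀) con (tag-∈ u) (∧'-elim₂ (∧'-elim₁ hyp₀)) ,
               λ q ⊢θ → ∋-complete s (∧'-elim₂ hyp₀) con q (cut ⊢θ (∧'-elim₁ (∧'-elim₁ hyp₀)))))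

  record IsCanonical (Rel : World → World → World → Set) : Set where
    field
      admissible  : Rel w u v → Admissible w u
      consistent  : Rel w u v → Consistent (conj (atom v))
      refutes-tag : Rel w u v → ¬ atom v ∋ tag u
      serial      : Admissible w u → ¬¬ ∃ (Rel w u)
      ▷-forth     : (φ ▷ ψ) ∈ S → atom w ∋ φ ▷ ψ → atom u ∋ φ → Rel w u v →
                    ¬¬ Σ World λ v' → Rel w u v' × atom v' ∋ ψ

  module _ {Rel} (C : IsCanonical Rel) where
    open IsCanonical C

    ▷-back : (φ ▷ ψ) ∈ S → Consistent (conj (atom w)) → ¬ atom w ∋ φ ▷ ψ →
             ¬¬ Σ World λ u → atom u ∋ φ × ∃ (Rel w u) × ∀ v → Rel w u v → ¬ atom v ∋ ψ
    ▷-back q con ∌▷ = do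
      u , ∋φ , refl , adm ← ▷-witness q con ∌▷
      v , r ← serial adm
      return (u , ∋φ , (v , r) , λ _ → refutes-tag)

    module _ (t : Table (length worlds)) (tab : Tabulates t Rel) where

      truth : θ ∈ S → Consistent (conj (atom w)) → (model t ⊩ w) θ ⇔ atom w ∋ θ
      truth {θ = var p} q con = mk⇔ id id
      truth {θ = ⊥'} {w} q con = mk⇔ (λ ()) (con ∘ conj-∋ (atom w) hyp₀ q)
      truth {θ = a ⇒ b} {w} q con = mk⇔
        (λ ⊩a⇒b → from ∋a⇒b (to ⊩b ∘ ⊩a⇒b ∘ from ⊩a))
        (λ ∋ → from ⊩b ∘ to ∋a⇒b ∋ ∘ to ⊩a)
        where
        ⊩a = truth (proj₁ (⇒-closed q)) con
        ⊩b = truth (proj₂ (⇒-closed q)) con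
        ∋a⇒b = ∋-⇒ (atom w) con q (proj₁ (⇒-closed q)) (proj₂ (⇒-closed q))
      truth {θ = φ ▷ ψ} {w} q con = mk⇔ forces→∋ ∋→forces
        where
        ⊩φ : ∀ {w u v} → Rel w u v → (model t ⊩ u) φ ⇔ atom u ∋ φ
        ⊩φ r = truth (proj₁ (▷-closed q)) (admissible-consistent (admissible r))
        ⊩ψ : ∀ {w u v} → Rel w u v → (model t ⊩ v) ψ ⇔ atom v ∋ ψ
        ⊩ψ r = truth (proj₂ (▷-closed q)) (consistent r)

        forces→∋ : (model t ⊩ w) (φ ▷ ψ) → atom w ∋ φ ▷ ψ
        forces→∋ ⊩▷ = decidable-stable (atom w ∋? φ ▷ ψ) λ ∌▷ → ▷-back q con ∌▷ λ where
          (u , ∋φ , (v , r) , refutes) →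
            let v' , r' , ⊩v'ψ = ⊩▷ u v (from (tab w u v) r) (from (⊩φ r) ∋φ)
                r'′ = to (tab w u v') r'
            in refutes v' r'′ (to (⊩ψ r'′) ⊩v'ψ)

        ∋→forces : atom w ∋ φ ▷ ψ → (model t ⊩ w) (φ ▷ ψ)
        ∋→forces ∋▷ u v r ⊩uφ =
          decidable-stable (Fin.any? λ v' → T? _ ×-dec ⊩-dec (model t) v' ψ) do
            v' , r' , ∋ψ ← ▷-forth q ∋▷ (to (⊩φ (to (tab w u v) r)) ⊩uφ) (to (tab w u v) r)
            return (v' , from (tab w u v') r' , from (⊩ψ r') ∋ψ)

    countermodel : ¬ ⊢[ d ] φ₀ →
      ¬¬ Σ (Table (length worlds)) λ t → Tabulates t Rel × Σ World λ w → ¬ (model t ⊩ w) φ₀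
    countermodel ⊬φ₀ = do
      t , tab ← ¬¬-tabulation Rel
      w , con , ∌φ₀ ← refuting-world ⊬φ₀
      return (t , tab , w , ∌φ₀ ∘ to (truth t tab φ₀∈S con))

  Successor : World → World → World → Set
  Successor w u v = Admissible w u × Consistent (conj (atom v)) × ¬ atom v ∋ tag u

  successor-canonical : IsCanonical Successor
  successor-canonical .IsCanonical.admissible  = proj₁
  successor-canonical .IsCanonical.consistent  = proj₁ ∘ proj₂
  successor-canonical .IsCanonical.refutes-tag = proj₂ ∘ proj₂
  successor-canonical .IsCanonical.serial adm = do
    v , con , ∌tag , _ ← successor-exists adm ▷-⊤
    return (v , adm , con , ∌tag)
  successor-canonical .IsCanonical.▷-forth q ∋▷ ∋φ (adm , _) = do
    v , con , ∌tag , closed ← successor-exists adm (conj-▷ q ∋▷ ∋φ)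
    return (v , (adm , con , ∌tag) , closed (proj₂ (▷-closed q)) hyp₀)

  refutation : ¬ ⊢[ d ] φ₀ → Σ Model λ M → Σ (Fin (n M)) λ w → ¬ (M ⊩ w) φ₀
  refutation ⊬φ₀
    with search-Table (λ t → Fin.any? λ w → ¬? (⊩-dec (model t) w φ₀))
                      (¬¬-map (map₂ proj₂) (countermodel successor-canonical ⊬φ₀))
  ... | t , w , ⊮φ₀ = model t , w , ⊮φ₀

  module _ (A4 : T d) where

    requirement : World → World → Form → Form
    requirement w u (φ ▷ ψ) with atom w ∋? φ ▷ ψ ×-dec atom u ∋? φ
    ... | yes _ = ψ
    ... | no  _ = ⊤'
    requirement w u _ = ⊤'

    requirement-▷ : θ ∈ S → [ conj (atom w) ] ⊢ conj (atom u) ▷ requirement w u θ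
    requirement-▷ {var _} _ = ▷-⊤
    requirement-▷ {⊥'}    _ = ▷-⊤
    requirement-▷ {_ ⇒ _} _ = ▷-⊤
    requirement-▷ {φ ▷ ψ} {w} {u} q with atom w ∋? φ ▷ ψ ×-dec atom u ∋? φ
    ... | yes (∋▷ , ∋φ) = conj-▷ q ∋▷ ∋φ
    ... | no  _         = ▷-⊤

    requirement-≡ : atom w ∋ φ ▷ ψ → atom u ∋ φ → requirement w u (φ ▷ ψ) ≡ ψ
    requirement-≡ {w} {φ} {ψ} {u} ∋▷ ∋φ with atom w ∋? φ ▷ ψ ×-dec atom u ∋? φ
    ... | yes _    = refl
    ... | no  ¬∋∋ = ⊥-elim (¬∋∋ (∋▷ , ∋φ))

    Meets-requirements : World → World → World → Set
    Meets-requirements w u v = ∀ {φ ψ} → (φ ▷ ψ) ∈ S → atom w ∋ φ ▷ ψ → atom u ∋ φ → atom v ∋ ψ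

    DeterministicSuccessor : World → World → World → Set
    DeterministicSuccessor w u v =
      Consistent (conj (atom v)) × ¬ atom v ∋ tag u × Meets-requirements w u v

    meets-requirements : (∀ {θ} → θ ∈ S → [ ⋀ (map (requirement w u) S) ] ⊢ θ → atom v ∋ θ) →
                         Meets-requirements w u v
    meets-requirements {w} {u} closed q ∋▷ ∋φ =
      closed (proj₂ (▷-closed q))
             (subst ([ _ ] ⊢_) (requirement-≡ ∋▷ ∋φ) (⋀-elim (∈-map⁺ (requirement w u) q) hyp₀))

    deterministic-successor-exists : Admissible w u → ¬¬ ∃ (DeterministicSuccessor w u)
    deterministic-successor-exists adm =
      ¬¬-map (map₂ (map₂ (map₂ meets-requirements)))
             (successor-exists adm (▷-⋀ A4 (All.map⁺ (All.tabulate requirement-▷))))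

    module _ (next : World → World → World)
             (next-spec : ∀ {w u} → Admissible w u → DeterministicSuccessor w u (next w u)) where

      Next : World → World → World → Set
      Next w u v = Admissible w u × v ≡ next w u

      next-canonical : IsCanonical Next
      next-canonical .IsCanonical.admissible              = proj₁
      next-canonical .IsCanonical.consistent  (adm , refl) = proj₁ (next-spec adm)
      next-canonical .IsCanonical.refutes-tag (adm , refl) = proj₁ (proj₂ (next-spec adm))
      next-canonical .IsCanonical.serial adm               = return (_ , adm , refl)
      next-canonical .IsCanonical.▷-forth q ∋▷ ∋φ (adm , refl) =
        return (_ , (adm , refl) , proj₂ (proj₂ (next-spec adm)) q ∋▷ ∋φ)

      next-functional : ∀ {w u v v'} → Next w u v → Next w u v' → v ≡ v'
      next-functional (_ , refl) (_ , refl) = refl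

    deterministic-countermodel : ¬ ⊢[ d ] φ₀ →
      ¬¬ Σ (Table (length worlds)) λ t → Deterministic (model t) × Σ World λ w → ¬ (model t ⊩ w) φ₀
    deterministic-countermodel ⊬φ₀ = do
      next , next-spec ← ¬¬-finite-choice _ λ w → ¬¬-finite-choice _ λ u →
                           ¬¬-independence-of-premise w deterministic-successor-exists
      let next-w-u w u = lookup (lookup next w) u
      t , tab , w , ⊮φ₀ ← countermodel (next-canonical next-w-u (next-spec _ _)) ⊬φ₀
      return (t , model-deterministic t tab (next-functional next-w-u (next-spec _ _)) , w , ⊮φ₀)

    deterministic-refutation : ¬ ⊢[ d ] φ₀ →
      Σ Model λ M → Deterministic M × Σ (Fin (n M)) λ w → ¬ (M ⊩ w) φ₀
    deterministic-refutation ⊬φ₀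
      with search-Table (λ t → deterministic? (model t) ×-dec Fin.any? λ w → ¬? (⊩-dec (model t) w φ₀))
                        (deterministic-countermodel ⊬φ₀)
    ... | t , det , w , ⊮φ₀ = model t , det , w , ⊮φ₀

theorem3 : ∀ (φ₀ : Form) →
    (¬ (⊢R φ₀) → Σ Model λ M → Σ (Fin (n M)) λ w → ¬ ((M ⊩ w) φ₀))
    × (¬ (⊢Rd φ₀) → Σ Model λ M → Deterministic M × Σ (Fin (n M)) λ w → ¬ ((M ⊩ w) φ₀))
theorem3 φ₀ = CanonicalModel.refutation false φ₀ , CanonicalModel.deterministic-refutation true φ₀ tt
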